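{- Let $G$ be a finite graph and let $\Gamma\subseteq\Omega(G)$ be such that $\Gamma-\{S\}$ is an hke collection for each $S\in\Gamma$. Then there exists an integer $m\ge 0$ such that $$\Big|\bigcap\Gamma_1-\bigcup\Gamma_2\Big|-\Big|\bigcap\Gamma_2-\bigcup\Gamma_1\Big|=(-1)^{|\Gamma_1|+1}m$$ holds for every partition $\{\Gamma_1,\Gamma_2\}$ of $\Gamma$ into two non-empty subcollections.
   Context: $\Omega(G)$ is the set of maximum independent sets of $G$ (independent sets of maximum cardinality). A collection $F$ of sets is an hereditary Konig–Egervary (hke) collection if there is a positive integer $\alpha$ such that $|\bigcup\Gamma|+|\bigcap\Gamma|=2\alpha$ for every non-empty subcollection $\Gamma\subseteq F$. -}

module Defs where

open import Data.Nat using (ℕ; zero; suc; _+_; _*_; _≤_; _<_)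
open import Data.Bool using (true; false)
open import Data.Vec using (_∷_; [])
open import Data.Fin using (Fin; zero; suc)
open import Data.Fin.Subset using (Subset; _∈_; _⊆_; ∣_∣; Nonempty; ⋃; ⋂)
open import Data.List using (List; []; _∷_)
open import Data.Product using (Σ; _×_; ∃)
open import Relation.Nullary using (¬_)
open import Relation.Binary.PropositionalEquality using (_≡_)
open import Function using (_∘_)

record Graph (n : ℕ) : Set₁ where
  field
    Adj   : Fin n → Fin n → Set
    sym   : ∀ {x y} → Adj x y → Adj y x
    irrfl : ∀ {x} → ¬ Adj x x

open Graph public

Independent : ∀ {n} → Graph n → Subset n → Set
Independent G S = ∀ {x y} → x ∈ S → y ∈ S → ¬ Adj G x y

MaxIndependent : ∀ {n} → Graph n → Subset n → Set
MaxIndependent G S =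
  Independent G S × (∀ T → Independent G T → ∣ T ∣ ≤ ∣ S ∣)

members : ∀ {k n} → (Fin k → Subset n) → Subset k → List (Subset n)
members {zero}  F []          = []
members {suc k} F (true ∷ C)  = F zero ∷ members (F ∘ suc) C
members {suc k} F (false ∷ C) = members (F ∘ suc) C

BigUnion : ∀ {k n} → (Fin k → Subset n) → Subset k → Subset n
BigUnion F C = ⋃ (members F C)

BigInter : ∀ {k n} → (Fin k → Subset n) → Subset k → Subset n
BigInter F C = ⋂ (members F C)

HKEOn : ∀ {k n} → (Fin k → Subset n) → Subset k → Set
HKEOn F D = Σ ℕ λ α → 0 < α ×
  (∀ C → C ⊆ D → Nonempty C → ∣ BigUnion F C ∣ + ∣ BigInter F C ∣ ≡ 2 * α)

-- Write excess A B = |⋂{Γ i | i ∈ A} ─ ⋃{Γ i | i ∈ B}| for index sets A, B. Sorting vertices by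
-- membership in Γ b splits excess A B into excess (A ∪ {b}) B + excess A (B ∪ {b}). When A and B
-- avoid b, the hke condition on Γ − {Γ b} keeps |⋃| + |⋂| constant as indices are added to B; adding a
-- enlarges ⋃ by excess {a} B and shrinks ⋂ by excess B {a}, so these agree, and with the splitting
-- identity excess A B = excess B A. Taking A = C and B = ∁ (C ∪ {b}), the imbalance
-- excess C (∁ C) − excess (∁ C) C changes sign when b is added to C, so it is (−1)^(|C|+1) times the
-- imbalance of a singleton. All singletons have the same imbalance, and it is nonnegative: trading
-- Γ c ─ ⋃{Γ l | l ≠ c} for ⋂{Γ l | l ≠ c} ─ Γ c in the maximum independent set Γ c keeps it independent.
module Submission where

open import Defs hiding (sym)
open import Data.Nat using (ℕ; zero; suc; _+_; _≤_)
open import Data.Nat.Properties using (+-suc; +-assoc; +-comm; +-cancelˡ-≡; +-cancelʳ-≡; +-cancelˡ-≤)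
open import Data.Integer using (ℤ; +_; -_; _-_; _*_; _^_; 0ℤ; +≤+) renaming (∣_∣ to ∣_∣ᶻ)
import Data.Integer as ℤ
import Data.Integer.Properties as ℤₚ
open import Data.Integer.Tactic.RingSolver using (solve-∀)
open import Data.Bool using (true; false)
open import Data.Bool.Properties using (∨-identityʳ)
open import Data.Vec using ([]; _∷_; here; there)
open import Data.Fin using (Fin; zero; suc; _≟_)
open import Data.Fin.Subset
  using (Subset; ⊤; ⊥; ∁; _∩_; _∪_; _─_; _⊂_; ⁅_⁆; ∣_∣; _∈_; _∉_; _⊆_; Nonempty; Empty; ⋃; ⋂)
  renaming (_-_ to _-ₛ_)
open import Data.Fin.Subset.Properties
open import Data.Fin.Subset.Induction using (⊂-wellFounded)
open import Induction.WellFounded using (Acc; acc)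
open import Data.List using ([])
open import Data.Product using (Σ; _,_; ∃; _×_; proj₁; proj₂)
open import Data.Sum using (inj₁; inj₂)
open import Level using (Level)
open import Relation.Nullary using (yes; no; contradiction)
open import Relation.Binary.PropositionalEquality
  using (_≡_; _≢_; refl; sym; trans; cong; cong₂; subst; subst₂; module ≡-Reasoning)
open import Function using (_∘_; case_of_)
open import Function.Definitions using (Injective)

private
  variable
    ℓ : Level
    n k : ℕ

x∈p─q⇒x∉q : ∀ {x : Fin n} {p q : Subset n} → x ∈ p ─ q → x ∉ q
x∈p─q⇒x∉q {p = true ∷ p} {false ∷ q} here ()
x∈p─q⇒x∉q {p = _ ∷ p} {_ ∷ q} (there x∈p─q) (there x∈q) = x∈p─q⇒x∉q {p = p} x∈p─q x∈q

∪-⊆ : ∀ {p q r : Subset n} → p ⊆ r → q ⊆ r → p ∪ q ⊆ r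
∪-⊆ {p = p} {q} p⊆r q⊆r x∈p∪q with x∈p∪q⁻ p q x∈p∪q
... | inj₁ x∈p = p⊆r x∈p
... | inj₂ x∈q = q⊆r x∈q

x∉p⇒p⊆⊤-x : ∀ {x : Fin n} {p} → x ∉ p → p ⊆ ⊤ -ₛ x
x∉p⇒p⊆⊤-x x∉p y∈p = x∈p∧x≢y⇒x∈p-y ∈⊤ λ { refl → x∉p y∈p }

p─q∩r≡p∩r─q : ∀ (p q r : Subset n) → (p ─ q) ∩ r ≡ p ∩ r ─ q
p─q∩r≡p∩r─q []      []          []      = refl
p─q∩r≡p∩r─q (_ ∷ p) (true  ∷ q) (_ ∷ r) = cong₂ _∷_ refl (p─q∩r≡p∩r─q p q r)
p─q∩r≡p∩r─q (_ ∷ p) (false ∷ q) (_ ∷ r) = cong₂ _∷_ refl (p─q∩r≡p∩r─q p q r)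

∁[p∪q]≡∁p─q : ∀ (p q : Subset n) → ∁ (p ∪ q) ≡ ∁ p ─ q
∁[p∪q]≡∁p─q []          []          = refl
∁[p∪q]≡∁p─q (true  ∷ p) (true  ∷ q) = cong₂ _∷_ refl (∁[p∪q]≡∁p─q p q)
∁[p∪q]≡∁p─q (true  ∷ p) (false ∷ q) = cong₂ _∷_ refl (∁[p∪q]≡∁p─q p q)
∁[p∪q]≡∁p─q (false ∷ p) (true  ∷ q) = cong₂ _∷_ refl (∁[p∪q]≡∁p─q p q)
∁[p∪q]≡∁p─q (false ∷ p) (false ∷ q) = cong₂ _∷_ refl (∁[p∪q]≡∁p─q p q)

∣p∣≡∣p∩q∣+∣p─q∣ : ∀ (p q : Subset n) → ∣ p ∣ ≡ ∣ p ∩ q ∣ + ∣ p ─ q ∣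
∣p∣≡∣p∩q∣+∣p─q∣ []          []          = refl
∣p∣≡∣p∩q∣+∣p─q∣ (true  ∷ p) (true  ∷ q) = cong suc (∣p∣≡∣p∩q∣+∣p─q∣ p q)
∣p∣≡∣p∩q∣+∣p─q∣ (true  ∷ p) (false ∷ q) = trans (cong suc (∣p∣≡∣p∩q∣+∣p─q∣ p q)) (sym (+-suc _ _))
∣p∣≡∣p∩q∣+∣p─q∣ (false ∷ p) (true  ∷ q) = ∣p∣≡∣p∩q∣+∣p─q∣ p q
∣p∣≡∣p∩q∣+∣p─q∣ (false ∷ p) (false ∷ q) = ∣p∣≡∣p∩q∣+∣p─q∣ p q

∣p∪q∣≡∣p∣+∣q─p∣ : ∀ (p q : Subset n) → ∣ p ∪ q ∣ ≡ ∣ p ∣ + ∣ q ─ p ∣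
∣p∪q∣≡∣p∣+∣q─p∣ []          []          = refl
∣p∪q∣≡∣p∣+∣q─p∣ (true  ∷ p) (_     ∷ q) = cong suc (∣p∪q∣≡∣p∣+∣q─p∣ p q)
∣p∪q∣≡∣p∣+∣q─p∣ (false ∷ p) (true  ∷ q) = trans (cong suc (∣p∪q∣≡∣p∣+∣q─p∣ p q)) (sym (+-suc _ _))
∣p∪q∣≡∣p∣+∣q─p∣ (false ∷ p) (false ∷ q) = ∣p∪q∣≡∣p∣+∣q─p∣ p q

∣p∩q∪r─p∣≡∣p∩q∣+∣r─p∣ : ∀ (p q r : Subset n) → ∣ p ∩ q ∪ (r ─ p) ∣ ≡ ∣ p ∩ q ∣ + ∣ r ─ p ∣
∣p∩q∪r─p∣≡∣p∩q∣+∣r─p∣ []          []          []          = refl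
∣p∩q∪r─p∣≡∣p∩q∣+∣r─p∣ (true  ∷ p) (true  ∷ q) (_     ∷ r) = cong suc (∣p∩q∪r─p∣≡∣p∩q∣+∣r─p∣ p q r)
∣p∩q∪r─p∣≡∣p∩q∣+∣r─p∣ (true  ∷ p) (false ∷ q) (_     ∷ r) = ∣p∩q∪r─p∣≡∣p∩q∣+∣r─p∣ p q r
∣p∩q∪r─p∣≡∣p∩q∣+∣r─p∣ (false ∷ p) (_     ∷ q) (true  ∷ r) =
  trans (cong suc (∣p∩q∪r─p∣≡∣p∩q∣+∣r─p∣ p q r)) (sym (+-suc _ _))
∣p∩q∪r─p∣≡∣p∩q∣+∣r─p∣ (false ∷ p) (_     ∷ q) (false ∷ r) = ∣p∩q∪r─p∣≡∣p∩q∣+∣r─p∣ p q r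

∣p─q∣≡∣p∩r─q∣+∣p─q∪r∣ : ∀ (p q r : Subset n) → ∣ p ─ q ∣ ≡ ∣ p ∩ r ─ q ∣ + ∣ p ─ q ∪ r ∣
∣p─q∣≡∣p∩r─q∣+∣p─q∪r∣ p q r =
  trans (∣p∣≡∣p∩q∣+∣p─q∣ (p ─ q) r)
        (cong₂ _+_ (cong ∣_∣ (p─q∩r≡p∩r─q p q r)) (cong ∣_∣ (p─q─r≡p─q∪r p q r)))

∣p∪⁅x⁆∣≡1+∣p∣ : ∀ {x : Fin n} {p} → x ∉ p → ∣ p ∪ ⁅ x ⁆ ∣ ≡ suc ∣ p ∣
∣p∪⁅x⁆∣≡1+∣p∣ {x = zero}  {false ∷ p} _   = cong (suc ∘ ∣_∣) (∪-identityʳ p)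
∣p∪⁅x⁆∣≡1+∣p∣ {x = zero}  {true  ∷ p} x∉p = contradiction here x∉p
∣p∪⁅x⁆∣≡1+∣p∣ {x = suc x} {true  ∷ p} x∉p = cong suc (∣p∪⁅x⁆∣≡1+∣p∣ (x∉p ∘ there))
∣p∪⁅x⁆∣≡1+∣p∣ {x = suc x} {false ∷ p} x∉p = ∣p∪⁅x⁆∣≡1+∣p∣ (x∉p ∘ there)

p-x∪⁅x⁆≡p : ∀ {x : Fin n} {p} → x ∈ p → (p -ₛ x) ∪ ⁅ x ⁆ ≡ p
p-x∪⁅x⁆≡p {x = zero}  {true ∷ p} here        = cong (true ∷_) (trans (∪-identityʳ (p ─ ⊥)) (p─⊥≡p p))
p-x∪⁅x⁆≡p {x = suc x} {s ∷ p}    (there x∈p) = cong₂ _∷_ (∨-identityʳ s) (p-x∪⁅x⁆≡p x∈p)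

x∉p-x : ∀ {x : Fin n} {p} → x ∉ p -ₛ x
x∉p-x {x = x} {p} x∈p-x = x∈p─q⇒x∉q {p = p} x∈p-x (x∈⁅x⁆ x)

Empty[p-x]⇒p≡⁅x⁆ : ∀ {x : Fin n} {p} → x ∈ p → Empty (p -ₛ x) → p ≡ ⁅ x ⁆
Empty[p-x]⇒p≡⁅x⁆ {x = x} {p} x∈p empty = ⊆-antisym p⊆⁅x⁆ ⁅x⁆⊆p
  where
  p⊆⁅x⁆ : p ⊆ ⁅ x ⁆
  p⊆⁅x⁆ {y} y∈p with y ≟ x
  ... | yes refl = x∈⁅x⁆ x
  ... | no  y≢x  = contradiction (y , x∈p∧x≢y⇒x∈p-y y∈p y≢x) empty
  ⁅x⁆⊆p : ⁅ x ⁆ ⊆ p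
  ⁅x⁆⊆p y∈⁅x⁆ = subst (_∈ p) (sym (x∈⁅y⁆⇒x≡y x y∈⁅x⁆)) x∈p

⁅y⁆≡∁⁅x⁆ : ∀ {x y : Fin n} → x ≢ y → Empty (∁ (⁅ x ⁆ ∪ ⁅ y ⁆)) → ⁅ y ⁆ ≡ ∁ ⁅ x ⁆
⁅y⁆≡∁⁅x⁆ {x = x} {y} x≢y empty = ⊆-antisym ⁅y⁆⊆∁⁅x⁆ ∁⁅x⁆⊆⁅y⁆
  where
  ⁅y⁆⊆∁⁅x⁆ : ⁅ y ⁆ ⊆ ∁ ⁅ x ⁆
  ⁅y⁆⊆∁⁅x⁆ z∈⁅y⁆ = x∉p⇒x∈∁p λ z∈⁅x⁆ → x≢y (trans (sym (x∈⁅y⁆⇒x≡y x z∈⁅x⁆)) (x∈⁅y⁆⇒x≡y y z∈⁅y⁆))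
  ∁⁅x⁆⊆⁅y⁆ : ∁ ⁅ x ⁆ ⊆ ⁅ y ⁆
  ∁⁅x⁆⊆⁅y⁆ {z} z∈∁⁅x⁆ with z ∈? ⁅ y ⁆
  ... | yes z∈⁅y⁆ = z∈⁅y⁆
  ... | no  z∉⁅y⁆ = contradiction
    (z , subst (z ∈_) (sym (∁[p∪q]≡∁p─q ⁅ x ⁆ ⁅ y ⁆)) (x∈p∧x∉q⇒x∈p─q z∈∁⁅x⁆ z∉⁅y⁆)) empty

nonempty-induction : (P : Subset n → Set ℓ) →
  (∀ a → P ⁅ a ⁆) →
  (∀ A a → a ∉ A → Nonempty A → P A → P (A ∪ ⁅ a ⁆)) →
  ∀ A → Nonempty A → P A
nonempty-induction P singleton insert A = go A (⊂-wellFounded A)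
  where
  go : ∀ A → Acc _⊂_ A → Nonempty A → P A
  go A (acc rec) (a , a∈A) with nonempty? (A -ₛ a)
  ... | no  empty = subst P (sym (Empty[p-x]⇒p≡⁅x⁆ a∈A empty)) (singleton a)
  ... | yes ne    = subst P (p-x∪⁅x⁆≡p a∈A)
      (insert (A -ₛ a) a (x∉p-x {p = A}) ne (go (A -ₛ a) (rec (x∈p⇒p-x⊂p a∈A)) ne))

∈BigInter⁺ : ∀ (Γ : Fin k → Subset n) {C x} → (∀ {i} → i ∈ C → x ∈ Γ i) → x ∈ BigInter Γ C
∈BigInter⁺ Γ {[]}        _  = ∈⊤
∈BigInter⁺ Γ {true  ∷ C} x∈ = x∈p∩q⁺ (x∈ here , ∈BigInter⁺ (Γ ∘ suc) (x∈ ∘ there))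
∈BigInter⁺ Γ {false ∷ C} x∈ = ∈BigInter⁺ (Γ ∘ suc) (x∈ ∘ there)

∈BigInter⁻ : ∀ (Γ : Fin k → Subset n) {C x i} → x ∈ BigInter Γ C → i ∈ C → x ∈ Γ i
∈BigInter⁻ Γ {true  ∷ C} x∈ here      = proj₁ (x∈p∩q⁻ _ _ x∈)
∈BigInter⁻ Γ {true  ∷ C} x∈ (there i∈) = ∈BigInter⁻ (Γ ∘ suc) (proj₂ (x∈p∩q⁻ _ _ x∈)) i∈
∈BigInter⁻ Γ {false ∷ C} x∈ (there i∈) = ∈BigInter⁻ (Γ ∘ suc) x∈ i∈

∈BigUnion⁺ : ∀ (Γ : Fin k → Subset n) {C x i} → i ∈ C → x ∈ Γ i → x ∈ BigUnion Γ C
∈BigUnion⁺ Γ {true  ∷ C} here       x∈ = x∈p∪q⁺ (inj₁ x∈)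
∈BigUnion⁺ Γ {true  ∷ C} (there i∈) x∈ = x∈p∪q⁺ (inj₂ (∈BigUnion⁺ (Γ ∘ suc) i∈ x∈))
∈BigUnion⁺ Γ {false ∷ C} (there i∈) x∈ = ∈BigUnion⁺ (Γ ∘ suc) i∈ x∈

∈BigUnion⁻ : ∀ (Γ : Fin k → Subset n) {C x} → x ∈ BigUnion Γ C → ∃ λ i → i ∈ C × x ∈ Γ i
∈BigUnion⁻ Γ {[]}        x∈ = contradiction x∈ ∉⊥
∈BigUnion⁻ Γ {true  ∷ C} x∈ with x∈p∪q⁻ _ _ x∈
... | inj₁ x∈Γ₀ = zero , here , x∈Γ₀
... | inj₂ x∈⋃  = let i , i∈ , x∈Γᵢ = ∈BigUnion⁻ (Γ ∘ suc) x∈⋃ in suc i , there i∈ , x∈Γᵢ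
∈BigUnion⁻ Γ {false ∷ C} x∈ = let i , i∈ , x∈Γᵢ = ∈BigUnion⁻ (Γ ∘ suc) x∈ in suc i , there i∈ , x∈Γᵢ

members-⊥ : ∀ (Γ : Fin k → Subset n) → members Γ ⊥ ≡ []
members-⊥ {k = zero}  Γ = refl
members-⊥ {k = suc k} Γ = members-⊥ (Γ ∘ suc)

BigInter-⁅⁆ : ∀ (Γ : Fin k → Subset n) a → BigInter Γ ⁅ a ⁆ ≡ Γ a
BigInter-⁅⁆ Γ zero    = trans (cong (λ l → Γ zero ∩ ⋂ l) (members-⊥ (Γ ∘ suc))) (∩-identityʳ (Γ zero))
BigInter-⁅⁆ Γ (suc a) = BigInter-⁅⁆ (Γ ∘ suc) a

BigUnion-⁅⁆ : ∀ (Γ : Fin k → Subset n) a → BigUnion Γ ⁅ a ⁆ ≡ Γ a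
BigUnion-⁅⁆ Γ zero    = trans (cong (λ l → Γ zero ∪ ⋃ l) (members-⊥ (Γ ∘ suc))) (∪-identityʳ (Γ zero))
BigUnion-⁅⁆ Γ (suc a) = BigUnion-⁅⁆ (Γ ∘ suc) a

BigInter-∪ : ∀ (Γ : Fin k → Subset n) A B → BigInter Γ (A ∪ B) ≡ BigInter Γ A ∩ BigInter Γ B
BigInter-∪ Γ A B = ⊆-antisym
  (λ x∈ → x∈p∩q⁺ (∈BigInter⁺ Γ (∈BigInter⁻ Γ x∈ ∘ p⊆p∪q B) , ∈BigInter⁺ Γ (∈BigInter⁻ Γ x∈ ∘ q⊆p∪q A B)))
  (λ x∈ → let x∈⋂A , x∈⋂B = x∈p∩q⁻ _ _ x∈ in ∈BigInter⁺ Γ λ i∈ → case x∈p∪q⁻ A B i∈ of λ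
    { (inj₁ i∈A) → ∈BigInter⁻ Γ x∈⋂A i∈A
    ; (inj₂ i∈B) → ∈BigInter⁻ Γ x∈⋂B i∈B })

BigUnion-∪ : ∀ (Γ : Fin k → Subset n) A B → BigUnion Γ (A ∪ B) ≡ BigUnion Γ A ∪ BigUnion Γ B
BigUnion-∪ Γ A B = ⊆-antisym
  (λ x∈ → let i , i∈ , x∈Γᵢ = ∈BigUnion⁻ Γ x∈ in case x∈p∪q⁻ A B i∈ of λ
    { (inj₁ i∈A) → x∈p∪q⁺ (inj₁ (∈BigUnion⁺ Γ i∈A x∈Γᵢ))
    ; (inj₂ i∈B) → x∈p∪q⁺ (inj₂ (∈BigUnion⁺ Γ i∈B x∈Γᵢ)) })
  (λ x∈ → case x∈p∪q⁻ _ _ x∈ of λ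
    { (inj₁ x∈⋃A) → let i , i∈ , x∈Γᵢ = ∈BigUnion⁻ Γ x∈⋃A in ∈BigUnion⁺ Γ (p⊆p∪q B i∈) x∈Γᵢ
    ; (inj₂ x∈⋃B) → let i , i∈ , x∈Γᵢ = ∈BigUnion⁻ Γ x∈⋃B in ∈BigUnion⁺ Γ (q⊆p∪q A B i∈) x∈Γᵢ })

BigInter-∪⁅⁆ : ∀ (Γ : Fin k → Subset n) A b → BigInter Γ (A ∪ ⁅ b ⁆) ≡ BigInter Γ A ∩ Γ b
BigInter-∪⁅⁆ Γ A b = trans (BigInter-∪ Γ A ⁅ b ⁆) (cong (BigInter Γ A ∩_) (BigInter-⁅⁆ Γ b))

BigUnion-∪⁅⁆ : ∀ (Γ : Fin k → Subset n) A b → BigUnion Γ (A ∪ ⁅ b ⁆) ≡ BigUnion Γ A ∪ Γ b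
BigUnion-∪⁅⁆ Γ A b = trans (BigUnion-∪ Γ A ⁅ b ⁆) (cong (BigUnion Γ A ∪_) (BigUnion-⁅⁆ Γ b))

m-n≡-[n-m] : ∀ m n → + m - + n ≡ - (+ n - + m)
m-n≡-[n-m] m n = trans (ℤₚ.m-n≡m⊖n m n) (trans (ℤₚ.⊖-swap m n) (cong -_ (sym (ℤₚ.m-n≡m⊖n n m))))

m+n≡o+p⇒m-p≡-[n-o] : ∀ {m n o p} → m + n ≡ o + p → + m - + p ≡ - (+ n - + o)
m+n≡o+p⇒m-p≡-[n-o] {m} {n} {o} {p} eq = begin
  + m - + p                                       ≡⟨ rearrange (+ m) (+ n) (+ o) (+ p) ⟩
  (+ m ℤ.+ + n) - (+ o ℤ.+ + p) ℤ.+ - (+ n - + o) ≡⟨ cong (λ x → x - (+ o ℤ.+ + p) ℤ.+ - (+ n - + o)) m+n≡o+p ⟩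
  (+ o ℤ.+ + p) - (+ o ℤ.+ + p) ℤ.+ - (+ n - + o) ≡⟨ cong (ℤ._+ - (+ n - + o)) (ℤₚ.+-inverseʳ (+ o ℤ.+ + p)) ⟩
  0ℤ ℤ.+ - (+ n - + o)                            ≡⟨ ℤₚ.+-identityˡ _ ⟩
  - (+ n - + o)                                   ∎
  where
  open ≡-Reasoning
  rearrange : ∀ x y z w → x - w ≡ (x ℤ.+ y) - (z ℤ.+ w) ℤ.+ - (y - z)
  rearrange = solve-∀
  m+n≡o+p : + m ℤ.+ + n ≡ + o ℤ.+ + p
  m+n≡o+p = trans (sym (ℤₚ.pos-+ m n)) (trans (cong +_ eq) (ℤₚ.pos-+ o p))

0≤i⇒0≤-i⇒i≡0 : ∀ {i} → 0ℤ ℤ.≤ i → 0ℤ ℤ.≤ - i → i ≡ 0ℤ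
0≤i⇒0≤-i⇒i≡0 (+≤+ {n = zero}  _) _  = refl
0≤i⇒0≤-i⇒i≡0 (+≤+ {n = suc _} _) ()

module _ {n} (G : Graph n) where

  exchange-independent : ∀ {k} (Γ : Fin k → Subset n) {L S} →
    (∀ i → Independent G (Γ i)) → Independent G S → Nonempty L →
    Independent G (S ∩ BigUnion Γ L ∪ (BigInter Γ L ─ S))
  exchange-independent Γ {L} {S} indΓ indS (l₀ , l₀∈L) = independent
    where
    ∈⋂─S⇒∈Γ : ∀ {x l} → x ∈ BigInter Γ L ─ S → l ∈ L → x ∈ Γ l
    ∈⋂─S⇒∈Γ x∈⋂─S = ∈BigInter⁻ Γ (p─q⊆p _ _ x∈⋂─S)
    independent : Independent G (S ∩ BigUnion Γ L ∪ (BigInter Γ L ─ S))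
    independent x∈T y∈T with x∈p∪q⁻ (S ∩ BigUnion Γ L) _ x∈T | x∈p∪q⁻ (S ∩ BigUnion Γ L) _ y∈T
    ... | inj₁ x∈S∩⋃ | inj₁ y∈S∩⋃ = indS (p∩q⊆p _ _ x∈S∩⋃) (p∩q⊆p _ _ y∈S∩⋃)
    ... | inj₁ x∈S∩⋃ | inj₂ y∈⋂─S = let l , l∈L , x∈Γₗ = ∈BigUnion⁻ Γ (p∩q⊆q _ _ x∈S∩⋃) in
      indΓ l x∈Γₗ (∈⋂─S⇒∈Γ y∈⋂─S l∈L)
    ... | inj₂ x∈⋂─S | inj₁ y∈S∩⋃ = let l , l∈L , y∈Γₗ = ∈BigUnion⁻ Γ (p∩q⊆q _ _ y∈S∩⋃) in
      indΓ l (∈⋂─S⇒∈Γ x∈⋂─S l∈L) y∈Γₗ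
    ... | inj₂ x∈⋂─S | inj₂ y∈⋂─S = indΓ l₀ (∈⋂─S⇒∈Γ x∈⋂─S l₀∈L) (∈⋂─S⇒∈Γ y∈⋂─S l₀∈L)

  ∣BigInter─S∣≤∣S─BigUnion∣ : ∀ {k} (Γ : Fin k → Subset n) {L S} →
    (∀ i → Independent G (Γ i)) → MaxIndependent G S → Nonempty L →
    ∣ BigInter Γ L ─ S ∣ ≤ ∣ S ─ BigUnion Γ L ∣
  ∣BigInter─S∣≤∣S─BigUnion∣ Γ {L} {S} indΓ (indS , maxS) neL = +-cancelˡ-≤ ∣ S ∩ BigUnion Γ L ∣ _ _
    (subst₂ _≤_ (∣p∩q∪r─p∣≡∣p∩q∣+∣r─p∣ S (BigUnion Γ L) (BigInter Γ L))
                (∣p∣≡∣p∩q∣+∣p─q∣ S (BigUnion Γ L))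
                (maxS _ (exchange-independent Γ indΓ indS neL)))

module _ {n k : ℕ} (Γ : Fin k → Subset n) where

  open import Algebra.Lattice.Properties.BooleanAlgebra (∪-∩-booleanAlgebra k) using (¬-involutive)

  excess : Subset k → Subset k → ℕ
  excess A B = ∣ BigInter Γ A ─ BigUnion Γ B ∣

  imbalance : Subset k → ℤ
  imbalance C = + excess C (∁ C) - + excess (∁ C) C

  excess-split : ∀ A B b → excess A B ≡ excess (A ∪ ⁅ b ⁆) B + excess A (B ∪ ⁅ b ⁆)
  excess-split A B b rewrite BigInter-∪⁅⁆ Γ A b | BigUnion-∪⁅⁆ Γ B b =
    ∣p─q∣≡∣p∩r─q∣+∣p─q∪r∣ (BigInter Γ A) (BigUnion Γ B) (Γ b)

  ∣BigUnion-∪⁅⁆∣ : ∀ B a → ∣ BigUnion Γ (B ∪ ⁅ a ⁆) ∣ ≡ ∣ BigUnion Γ B ∣ + excess ⁅ a ⁆ B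
  ∣BigUnion-∪⁅⁆∣ B a rewrite BigUnion-∪⁅⁆ Γ B a | BigInter-⁅⁆ Γ a =
    ∣p∪q∣≡∣p∣+∣q─p∣ (BigUnion Γ B) (Γ a)

  ∣BigInter∣-∪⁅⁆ : ∀ B a → ∣ BigInter Γ B ∣ ≡ ∣ BigInter Γ (B ∪ ⁅ a ⁆) ∣ + excess B ⁅ a ⁆
  ∣BigInter∣-∪⁅⁆ B a rewrite BigInter-∪⁅⁆ Γ B a | BigUnion-⁅⁆ Γ a =
    ∣p∣≡∣p∩q∣+∣p─q∣ (BigInter Γ B) (Γ a)

  excess-⁅⁆-sym : ∀ B a →
    ∣ BigUnion Γ (B ∪ ⁅ a ⁆) ∣ + ∣ BigInter Γ (B ∪ ⁅ a ⁆) ∣ ≡ ∣ BigUnion Γ B ∣ + ∣ BigInter Γ B ∣ →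
    excess ⁅ a ⁆ B ≡ excess B ⁅ a ⁆
  excess-⁅⁆-sym B a eq = +-cancelʳ-≡ t _ _ (trans (+-cancelˡ-≡ u _ _ (begin
      u + (excess ⁅ a ⁆ B + t)  ≡⟨ sym (+-assoc u _ t) ⟩
      u + excess ⁅ a ⁆ B + t    ≡⟨ cong (_+ t) (sym (∣BigUnion-∪⁅⁆∣ B a)) ⟩
      ∣ BigUnion Γ (B ∪ ⁅ a ⁆) ∣ + t ≡⟨ eq ⟩
      u + ∣ BigInter Γ B ∣      ≡⟨ cong (λ x → u + x) (∣BigInter∣-∪⁅⁆ B a) ⟩
      u + (t + excess B ⁅ a ⁆)  ∎)) (+-comm t _))
    where
    open ≡-Reasoning
    u t : ℕ
    u = ∣ BigUnion Γ B ∣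
    t = ∣ BigInter Γ (B ∪ ⁅ a ⁆) ∣

  excess-sym : ∀ {D} → HKEOn Γ D → ∀ A → Nonempty A → A ⊆ D →
    ∀ {B} → B ⊆ D → Nonempty B → excess A B ≡ excess B A
  excess-sym {D} (_ , _ , hke) = nonempty-induction P base step
    where
    open ≡-Reasoning
    P : Subset k → Set
    P A = A ⊆ D → ∀ {B} → B ⊆ D → Nonempty B → excess A B ≡ excess B A
    a∈B∪⁅a⁆ : ∀ {B a} → a ∈ B ∪ ⁅ a ⁆
    a∈B∪⁅a⁆ {a = a} = x∈p∪q⁺ (inj₂ (x∈⁅x⁆ a))
    base : ∀ a → P ⁅ a ⁆
    base a ⁅a⁆⊆D {B} B⊆D neB = excess-⁅⁆-sym B a
      (trans (hke (B ∪ ⁅ a ⁆) (∪-⊆ B⊆D ⁅a⁆⊆D) (a , a∈B∪⁅a⁆)) (sym (hke B B⊆D neB)))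
    step : ∀ A a → a ∉ A → Nonempty A → P A → P (A ∪ ⁅ a ⁆)
    step A a _ _ ih A∪⁅a⁆⊆D {B} B⊆D neB = +-cancelʳ-≡ (excess A (B ∪ ⁅ a ⁆)) _ _ (begin
        excess (A ∪ ⁅ a ⁆) B + excess A (B ∪ ⁅ a ⁆) ≡⟨ sym (excess-split A B a) ⟩
        excess A B                                  ≡⟨ ih A⊆D B⊆D neB ⟩
        excess B A                                  ≡⟨ excess-split B A a ⟩
        excess (B ∪ ⁅ a ⁆) A + excess B (A ∪ ⁅ a ⁆) ≡⟨ +-comm _ (excess B (A ∪ ⁅ a ⁆)) ⟩
        excess B (A ∪ ⁅ a ⁆) + excess (B ∪ ⁅ a ⁆) A
          ≡⟨ cong (λ x → excess B (A ∪ ⁅ a ⁆) + x) (sym (ih A⊆D B∪⁅a⁆⊆D (a , a∈B∪⁅a⁆))) ⟩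
        excess B (A ∪ ⁅ a ⁆) + excess A (B ∪ ⁅ a ⁆) ∎)
      where
      A⊆D : A ⊆ D
      A⊆D x∈A = A∪⁅a⁆⊆D (p⊆p∪q ⁅ a ⁆ x∈A)
      B∪⁅a⁆⊆D : B ∪ ⁅ a ⁆ ⊆ D
      B∪⁅a⁆⊆D = ∪-⊆ B⊆D λ x∈⁅a⁆ → A∪⁅a⁆⊆D (q⊆p∪q A ⁅ a ⁆ x∈⁅a⁆)

  excess-∪⁅⁆-balance : ∀ {C b} → HKEOn Γ (⊤ -ₛ b) → Nonempty C → b ∉ C → Nonempty (∁ (C ∪ ⁅ b ⁆)) →
    excess (C ∪ ⁅ b ⁆) (∁ (C ∪ ⁅ b ⁆)) + excess C (∁ C)
      ≡ excess (∁ C) C + excess (∁ (C ∪ ⁅ b ⁆)) (C ∪ ⁅ b ⁆)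
  excess-∪⁅⁆-balance {C} {b} hke neC b∉C neB = begin
    excess (C ∪ ⁅ b ⁆) B + excess C (∁ C)
      ≡⟨ cong (λ X → excess (C ∪ ⁅ b ⁆) B + excess C X) (sym B∪⁅b⁆≡∁C) ⟩
    excess (C ∪ ⁅ b ⁆) B + excess C (B ∪ ⁅ b ⁆)
      ≡⟨ sym (excess-split C B b) ⟩
    excess C B
      ≡⟨ excess-sym hke C neC (x∉p⇒p⊆⊤-x b∉C) (x∉p⇒p⊆⊤-x b∉B) neB ⟩
    excess B C
      ≡⟨ excess-split B C b ⟩
    excess (B ∪ ⁅ b ⁆) C + excess B (C ∪ ⁅ b ⁆)
      ≡⟨ cong (λ X → excess X C + excess B (C ∪ ⁅ b ⁆)) B∪⁅b⁆≡∁C ⟩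
    excess (∁ C) C + excess B (C ∪ ⁅ b ⁆)
      ∎
    where
    open ≡-Reasoning
    B : Subset k
    B = ∁ (C ∪ ⁅ b ⁆)
    b∉B : b ∉ B
    b∉B = x∈p⇒x∉∁p (x∈p∪q⁺ (inj₂ (x∈⁅x⁆ b)))
    B∪⁅b⁆≡∁C : B ∪ ⁅ b ⁆ ≡ ∁ C
    B∪⁅b⁆≡∁C = trans (cong (_∪ ⁅ b ⁆) (∁[p∪q]≡∁p─q C ⁅ b ⁆)) (p-x∪⁅x⁆≡p (x∉p⇒x∈∁p b∉C))

  imbalance-∪⁅⁆ : ∀ {C b} → HKEOn Γ (⊤ -ₛ b) → Nonempty C → b ∉ C → Nonempty (∁ (C ∪ ⁅ b ⁆)) →
    imbalance (C ∪ ⁅ b ⁆) ≡ - imbalance C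
  imbalance-∪⁅⁆ {C} {b} hke neC b∉C neB =
    m+n≡o+p⇒m-p≡-[n-o] {excess C′ (∁ C′)} {excess C (∁ C)} {excess (∁ C) C} {excess (∁ C′) C′}
      (excess-∪⁅⁆-balance hke neC b∉C neB)
    where
    C′ : Subset k
    C′ = C ∪ ⁅ b ⁆

  imbalance-∁ : ∀ C → imbalance (∁ C) ≡ - imbalance C
  imbalance-∁ C rewrite ¬-involutive C = m-n≡-[n-m] (excess (∁ C) C) (excess C (∁ C))

  0≤imbalance-⁅⁆ : ∀ (G : Graph n) → (∀ i → MaxIndependent G (Γ i)) →
    ∀ c → Nonempty (∁ ⁅ c ⁆) → 0ℤ ℤ.≤ imbalance ⁅ c ⁆
  0≤imbalance-⁅⁆ G maxInd c ne = ℤₚ.i≤j⇒0≤j-i (+≤+ excess-≤)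
    where
    excess-≤ : excess (∁ ⁅ c ⁆) ⁅ c ⁆ ≤ excess ⁅ c ⁆ (∁ ⁅ c ⁆)
    excess-≤ rewrite BigInter-⁅⁆ Γ c | BigUnion-⁅⁆ Γ c =
      ∣BigInter─S∣≤∣S─BigUnion∣ G Γ (proj₁ ∘ maxInd) (maxInd c) ne

  imbalance-⁅⁆-const : ∀ (G : Graph n) → (∀ i → MaxIndependent G (Γ i)) → (∀ b → HKEOn Γ (⊤ -ₛ b)) →
    ∀ c j → imbalance ⁅ c ⁆ ≡ imbalance ⁅ j ⁆
  imbalance-⁅⁆-const G maxInd hke c j with c ≟ j
  ... | yes refl = refl
  ... | no c≢j with nonempty? (∁ (⁅ c ⁆ ∪ ⁅ j ⁆))
  ...   | yes ne = ℤₚ.neg-injective (begin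
      - imbalance ⁅ c ⁆          ≡⟨ sym (imbalance-∪⁅⁆ (hke j) (c , x∈⁅x⁆ c) (x≢y⇒x∉⁅y⁆ (c≢j ∘ sym)) ne) ⟩
      imbalance (⁅ c ⁆ ∪ ⁅ j ⁆) ≡⟨ cong imbalance (∪-comm ⁅ c ⁆ ⁅ j ⁆) ⟩
      imbalance (⁅ j ⁆ ∪ ⁅ c ⁆) ≡⟨ imbalance-∪⁅⁆ (hke c) (j , x∈⁅x⁆ j) (x≢y⇒x∉⁅y⁆ c≢j)
                                     (subst (Nonempty ∘ ∁) (∪-comm ⁅ c ⁆ ⁅ j ⁆) ne) ⟩
      - imbalance ⁅ j ⁆          ∎)
    where open ≡-Reasoning
  -- Here k = 2: the imbalances of ⁅ c ⁆ and ⁅ j ⁆ = ∁ ⁅ c ⁆ are opposite and both nonnegative.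
  ...   | no empty =
    trans imbalance⁅c⁆≡0 (sym (trans imbalance⁅j⁆≡-imbalance⁅c⁆ (cong -_ imbalance⁅c⁆≡0)))
    where
    imbalance⁅j⁆≡-imbalance⁅c⁆ : imbalance ⁅ j ⁆ ≡ - imbalance ⁅ c ⁆
    imbalance⁅j⁆≡-imbalance⁅c⁆ = trans (cong imbalance (⁅y⁆≡∁⁅x⁆ c≢j empty)) (imbalance-∁ ⁅ c ⁆)
    imbalance⁅c⁆≡0 : imbalance ⁅ c ⁆ ≡ 0ℤ
    imbalance⁅c⁆≡0 = 0≤i⇒0≤-i⇒i≡0
      (0≤imbalance-⁅⁆ G maxInd c (j , x∉p⇒x∈∁p (x≢y⇒x∉⁅y⁆ (c≢j ∘ sym))))
      (subst (0ℤ ℤ.≤_) imbalance⁅j⁆≡-imbalance⁅c⁆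
        (0≤imbalance-⁅⁆ G maxInd j (c , x∉p⇒x∈∁p (x≢y⇒x∉⁅y⁆ c≢j))))

  imbalance-alternates : ∀ {z} → (∀ b → HKEOn Γ (⊤ -ₛ b)) →
    (∀ c → Nonempty (∁ ⁅ c ⁆) → imbalance ⁅ c ⁆ ≡ z) →
    ∀ C → Nonempty C → Nonempty (∁ C) → imbalance C ≡ (- (+ 1)) ^ suc ∣ C ∣ * z
  imbalance-alternates {z} hke imbalance-⁅⁆≡z = nonempty-induction P base step
    where
    open ≡-Reasoning
    P : Subset k → Set
    P C = Nonempty (∁ C) → imbalance C ≡ (- (+ 1)) ^ suc ∣ C ∣ * z
    base : ∀ c → P ⁅ c ⁆
    base c ne = begin
      imbalance ⁅ c ⁆               ≡⟨ imbalance-⁅⁆≡z c ne ⟩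
      z                             ≡⟨ sym (ℤₚ.*-identityˡ z) ⟩
      (- (+ 1)) ^ 2 * z             ≡⟨ cong (λ s → (- (+ 1)) ^ suc s * z) (sym (∣⁅x⁆∣≡1 c)) ⟩
      (- (+ 1)) ^ suc ∣ ⁅ c ⁆ ∣ * z ∎
    step : ∀ C c → c ∉ C → Nonempty C → P C → P (C ∪ ⁅ c ⁆)
    step C c c∉C neC ih (x , x∈∁[C∪⁅c⁆]) = begin
      imbalance (C ∪ ⁅ c ⁆)                 ≡⟨ imbalance-∪⁅⁆ (hke c) neC c∉C (x , x∈∁[C∪⁅c⁆]) ⟩
      - imbalance C                         ≡⟨ cong -_ (ih (x , p⊆q⇒∁p⊇∁q (p⊆p∪q {p = C} ⁅ c ⁆) x∈∁[C∪⁅c⁆])) ⟩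
      - ((- (+ 1)) ^ suc ∣ C ∣ * z)         ≡⟨ sym (ℤₚ.-1*i≡-i _) ⟩
      - (+ 1) * ((- (+ 1)) ^ suc ∣ C ∣ * z) ≡⟨ sym (ℤₚ.*-assoc (- (+ 1)) ((- (+ 1)) ^ suc ∣ C ∣) z) ⟩
      (- (+ 1)) ^ suc (suc ∣ C ∣) * z       ≡⟨ cong (λ s → (- (+ 1)) ^ suc s * z) (sym (∣p∪⁅x⁆∣≡1+∣p∣ c∉C)) ⟩
      (- (+ 1)) ^ suc ∣ C ∪ ⁅ c ⁆ ∣ * z     ∎

corollary2p8 : ∀ {n k} (G : Graph n) (Γ : Fin k → Subset n) →
  Injective _≡_ _≡_ Γ →
  (∀ i → MaxIndependent G (Γ i)) →
  (∀ i → HKEOn Γ (⊤ Data.Fin.Subset.- i)) →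
  Σ ℕ λ m → ∀ (C : Subset k) → Nonempty C → Nonempty (∁ C) →
    (+ ∣ BigInter Γ C ─ BigUnion Γ (∁ C) ∣) - (+ ∣ BigInter Γ (∁ C) ─ BigUnion Γ C ∣)
      ≡ ((- (+ 1)) ^ (suc ∣ C ∣)) * (+ m)
corollary2p8 {k = zero}  _ _ _ _      _   = 0 , λ { _ (() , _) _ }
corollary2p8 {k = suc k} G Γ _ maxInd hke =
  ∣ imbalance Γ ⁅ zero ⁆ ∣ᶻ , imbalance-alternates Γ hke imbalance-⁅⁆≡m
  where
  open ≡-Reasoning
  imbalance-⁅⁆≡m : ∀ c → Nonempty (∁ ⁅ c ⁆) → imbalance Γ ⁅ c ⁆ ≡ + ∣ imbalance Γ ⁅ zero ⁆ ∣ᶻ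
  imbalance-⁅⁆≡m c ne = begin
    imbalance Γ ⁅ c ⁆            ≡⟨ sym (ℤₚ.0≤i⇒+∣i∣≡i (0≤imbalance-⁅⁆ Γ G maxInd c ne)) ⟩
    + ∣ imbalance Γ ⁅ c ⁆ ∣ᶻ     ≡⟨ cong (+_ ∘ ∣_∣ᶻ) (imbalance-⁅⁆-const Γ G maxInd hke c zero) ⟩
    + ∣ imbalance Γ ⁅ zero ⁆ ∣ᶻ  ∎
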